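{- Let $p$ be a prime, $q$ a power of $p$, $m\geq1$, $\sigma:\mathcal A_m\to\mathcal A_m^*$ a $p$-uniform morphism, $\varphi:\mathcal A_m\to\mathbb{F}_q$ a coding, and $U,V\in\mathcal A_m^*$ with $k=|U|\geq1$ and $\ell=|V|\geq 1$. For $n\geq1$ let $U_n=\varphi(\sigma^n(U))$, $V_n=\varphi(\sigma^n(V))$, $$Q_n(T)=T^{kp^n-1}(T^{\ell p^n}-1),\qquad P_n(T)=P_{U_n}(T)(T^{\ell p^n}-1)+P_{V_n}(T).$$ Then $\gcd(P_n,Q_n)=1$ in $\mathbb{F}_q[T]$ if and only if (i) $P_{U_n}(0)\neq P_{V_n}(0)$, and (ii) $P_{V_n}(\alpha)\neq0$ for every $\alpha\in\overline{\mathbb{F}}_p$ with $\alpha^{\ell}=1$.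
   Context: $\mathcal A_m=\{0,\dots,m-1\}$; a $p$-uniform morphism maps each letter to a word of length $p$; a coding is a letter-to-letter map extended to words. For a word $W=w_0\cdots w_{r-1}$ over $\mathbb{F}_q$, $P_W(T)=\sum_{j=0}^{r-1}w_{r-1-j}T^j$ (and $P_\varepsilon=0$). $\overline{\mathbb{F}}_p$ is an algebraic closure of $\mathbb{F}_p$. -}

module Defs where

open import Level using (Level; _⊔_; suc)
open import Data.Nat as ℕ using (ℕ; zero; _^_)
open import Data.Fin using (Fin)
open import Data.List using (List; []; _∷_; map; replicate; _++_; reverse; concatMap; foldl; length)
open import Data.Vec using (Vec; toList)
open import Data.Product using (Σ; ∃; _×_; _,_)
open import Data.Unit.Polymorphic using (⊤)
open import Relation.Binary.PropositionalEquality using (_≡_)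
open import Relation.Nullary using (¬_)
open import Algebra.Bundles using (CommutativeRing)
open import Algebra.Morphism.Structures using (IsRingHomomorphism)
open import Function using (_∘_)

-- A p-uniform morphism σ : 𝒜_m → 𝒜_m^* is given as Fin m → Vec (Fin m) p;
-- its extension to words:
applyMorph : ∀ {m p} → (Fin m → Vec (Fin m) p) → List (Fin m) → List (Fin m)
applyMorph σ = concatMap (toList ∘ σ)

iterMorph : ∀ {m p} → (Fin m → Vec (Fin m) p) → ℕ → List (Fin m) → List (Fin m)
iterMorph σ zero    w = w
iterMorph σ (ℕ.suc n) w = applyMorph σ (iterMorph σ n w)

-- Fields, finite cardinality, polynomials (coefficient lists, lowest degree first)

module _ {c ℓ : Level} (R : CommutativeRing c ℓ) where
  open CommutativeRing R

  record IsField : Set (c ⊔ ℓ) where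
    field
      1≉0    : ¬ (1# ≈ 0#)
      inverse : ∀ x → ¬ (x ≈ 0#) → ∃ λ y → x * y ≈ 1#

  HasCard : ℕ → Set (c ⊔ ℓ)
  HasCard q = Σ (Fin q → Carrier) λ f →
    (∀ i j → f i ≈ f j → i ≡ j) × (∀ x → ∃ λ i → f i ≈ x)

  Pol : Set c
  Pol = List Carrier

  -- equality of polynomials (ignoring trailing zero coefficients)
  _≈ₚ_ : Pol → Pol → Set ℓ
  []       ≈ₚ []       = ⊤
  []       ≈ₚ (b ∷ g)  = (b ≈ 0#) × ([] ≈ₚ g)
  (a ∷ f)  ≈ₚ []       = (a ≈ 0#) × (f ≈ₚ [])
  (a ∷ f)  ≈ₚ (b ∷ g)  = (a ≈ b) × (f ≈ₚ g)

  _+ₚ_ : Pol → Pol → Pol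
  []      +ₚ g       = g
  (a ∷ f) +ₚ []      = a ∷ f
  (a ∷ f) +ₚ (b ∷ g) = (a + b) ∷ (f +ₚ g)

  -ₚ_ : Pol → Pol
  -ₚ f = map -_ f

  _*ₚ_ : Pol → Pol → Pol
  []      *ₚ g = []
  (a ∷ f) *ₚ g = map (a *_) g +ₚ (0# ∷ (f *ₚ g))

  oneₚ : Pol
  oneₚ = 1# ∷ []

  Xpow : ℕ → Pol
  Xpow n = replicate n 0# ++ (1# ∷ [])

  _∣ₚ_ : Pol → Pol → Set (c ⊔ ℓ)
  d ∣ₚ f = ∃ λ e → (d *ₚ e) ≈ₚ f

  CoprimePol : Pol → Pol → Set (c ⊔ ℓ)
  CoprimePol f g = ∀ d → d ∣ₚ f → d ∣ₚ g → d ∣ₚ oneₚ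

  eval : Pol → Carrier → Carrier
  eval []      x = 0#
  eval (a ∷ f) x = a + x * eval f x

  pow : Carrier → ℕ → Carrier
  pow x zero      = 1#
  pow x (ℕ.suc n) = x * pow x n

  -- P_W for a word W = w_0 ⋯ w_{r-1}: P_W(T) = Σ_j w_{r-1-j} T^j,
  -- i.e. the coefficient list (lowest first) is the reversed word.
  PW : List Carrier → Pol
  PW W = reverse W

record AlgClosure {c ℓ : Level} (F : CommutativeRing c ℓ) (c' ℓ' : Level)
       : Set (c ⊔ ℓ ⊔ suc (c' ⊔ ℓ')) where
  field
    K        : CommutativeRing c' ℓ'
    K-field  : IsField K
    ι        : CommutativeRing.Carrier F → CommutativeRing.Carrier K
    ι-hom    : IsRingHomomorphism (CommutativeRing.rawRing F) (CommutativeRing.rawRing K) ι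
    -- algebraically closed: every nonconstant polynomial has a root
    closed   : ∀ a f → ¬ (_≈ₚ_ K f []) →
               ∃ λ x → CommutativeRing._≈_ K (eval K (a ∷ f) x) (CommutativeRing.0# K)
    algebraic : ∀ x → ∃ λ (f : Pol F) → ¬ (_≈ₚ_ F f []) ×
               CommutativeRing._≈_ K (eval K (map ι f) x) (CommutativeRing.0# K)

module _ {c ℓ : Level} (F : CommutativeRing c ℓ) where
  open CommutativeRing F

  XpowMinusOne : ℕ → Pol F
  XpowMinusOne N = _+ₚ_ F (Xpow F N) (-ₚ_ F (oneₚ F))

  codedIter : ∀ {m p} → (Fin m → Vec (Fin m) p) → (Fin m → Carrier) →
              ℕ → List (Fin m) → List Carrier
  codedIter σ φ n W = map φ (iterMorph σ n W)

  Qn : (p k l n : ℕ) → Pol F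
  Qn p k l n = _*ₚ_ F (Xpow F (k ℕ.* p ^ n ℕ.∸ 1)) (XpowMinusOne (l ℕ.* p ^ n))

  Pn : (p l : ℕ) → (Un Vn : List Carrier) → (n : ℕ) → Pol F
  Pn p l Un Vn n = _+ₚ_ F (_*ₚ_ F (PW F Un) (XpowMinusOne (l ℕ.* p ^ n))) (PW F Vn)

-- With X = T^N - 1 and N = l p^n we have P_n = A X + B and Q_n = T^j X, where
-- A = P_{U_n}, B = P_{V_n} and j = k p^n - 1 ≥ 1.  If P_n and Q_n have a non-unit common
-- factor, it has a root x in the algebraic closure.  For x = 0 this says P_n(0) = B(0) - A(0)
-- vanishes.  For x ≠ 0 it gives X(x) = 0, hence x^N = 1 and B(x) = P_n(x) = 0; as
-- y ↦ y^(p^n) is injective in characteristic p, (x^l)^(p^n) = 1 forces x^l = 1.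
-- Conversely, if A(0) = B(0) then T divides P_n and Q_n, and an α with α^l = 1 and B(α) = 0
-- is a nonzero common root of P_n and X; a Euclidean algorithm on P_n and X then yields a
-- common divisor in F_q[T] that vanishes at α and so is not a unit.

module Submission where

open import Defs
open import Level using (Level; _⊔_)
open import Data.Nat using (ℕ; _≤_; _^_)
open import Data.Nat.Primality using (Prime)
open import Data.Fin using (Fin)
open import Data.List using (List; length; map)
open import Data.Vec using (Vec)
open import Data.Product using (∃; _×_)
open import Relation.Binary.PropositionalEquality using (_≡_)
open import Relation.Nullary using (¬_)
open import Function.Bundles using (_⇔_; mk⇔)
open import Function using (_∘_)
open import Algebra.Bundles using (CommutativeRing)

open import Data.Nat using (zero; suc; _∸_; _<_; z≤n; s≤s)
import Data.Nat as ℕ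
import Data.Nat.Properties as ℕₚ
open import Data.Nat.Combinatorics using (_C_; nCk+nC[k+1]≡[n+1]C[k+1]; k>n⇒nCk≡0; nC1≡n; nCn≡1)
open import Data.Nat.Divisibility using (divides; ∣⇒≤) renaming (_∣_ to _∣ℕ_)
open import Data.Nat.Primality using (euclidsLemma; ¬prime[0]; ¬prime[1]; prime⇒nonZero; prime⇒nonTrivial)
open import Data.Fin using (toℕ; fromℕ; inject₁) renaming (zero to fzero; suc to fsuc)
import Data.Fin.Properties as Finₚ
open import Data.List using ([]; _∷_; replicate; _++_)
import Data.List.Properties
open import Data.Product using (Σ; _,_; proj₁; proj₂)
open import Data.Sum using (_⊎_; inj₁; inj₂)
open import Data.Empty using (⊥; ⊥-elim)
open import Data.Unit.Polymorphic using (tt)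
import Relation.Binary.PropositionalEquality as ≡
open import Relation.Nullary using (Dec; yes; no)
open import Algebra.Morphism.Structures using (IsRingHomomorphism)

-- Binomial coefficients

module _ where
  open import Data.Nat using (_+_; _*_)
  open ≡ using (refl; cong; cong₂)

  [k+1]*[n+1]C[k+1]≡[n+1]*nCk : ∀ n k → suc k * (suc n C suc k) ≡ suc n * (n C k)
  [k+1]*[n+1]C[k+1]≡[n+1]*nCk zero zero = refl
  [k+1]*[n+1]C[k+1]≡[n+1]*nCk zero (suc k)
    rewrite k>n⇒nCk≡0 {1} {suc (suc k)} (s≤s (s≤s z≤n)) | k>n⇒nCk≡0 {0} {suc k} (s≤s z≤n)
    = ℕₚ.*-zeroʳ (suc (suc k))
  [k+1]*[n+1]C[k+1]≡[n+1]*nCk (suc n) zero rewrite nC1≡n (suc (suc n)) = ℕₚ.*-comm 1 (suc (suc n))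
  [k+1]*[n+1]C[k+1]≡[n+1]*nCk (suc n) (suc k) = begin
    suc (suc k) * (suc (suc n) C suc (suc k))
      ≡⟨ cong (suc (suc k) *_) (≡.sym (nCk+nC[k+1]≡[n+1]C[k+1] (suc n) (suc k))) ⟩
    suc (suc k) * (A + B)
      ≡⟨ solve 3 (λ k A B → (con 2 :+ k) :* (A :+ B) := A :+ (con 1 :+ k) :* A :+ (con 2 :+ k) :* B)
           refl k A B ⟩
    A + suc k * A + suc (suc k) * B
      ≡⟨ cong₂ (λ u v → A + u + v) ([k+1]*[n+1]C[k+1]≡[n+1]*nCk n k) ([k+1]*[n+1]C[k+1]≡[n+1]*nCk n (suc k)) ⟩
    A + suc n * (n C k) + suc n * (n C suc k)
      ≡⟨ solve 4 (λ A n x y → A :+ (con 1 :+ n) :* x :+ (con 1 :+ n) :* y := A :+ (con 1 :+ n) :* (x :+ y))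
           refl A n (n C k) (n C suc k) ⟩
    A + suc n * (n C k + n C suc k)
      ≡⟨ cong (λ u → A + suc n * u) (nCk+nC[k+1]≡[n+1]C[k+1] n k) ⟩
    A + suc n * A
      ≡⟨ solve 2 (λ A n → A :+ (con 1 :+ n) :* A := (con 2 :+ n) :* A) refl A n ⟩
    suc (suc n) * A
      ∎
    where
    open ≡.≡-Reasoning
    open import Data.Nat.Solver using (module +-*-Solver)
    open +-*-Solver
    A = suc n C suc k
    B = suc n C suc (suc k)

  prime∣pCk : ∀ {p k} → Prime p → 0 < k → k < p → p ∣ℕ p C k
  prime∣pCk {suc n} {suc k} p-prime _ (s≤s k<n)
    with euclidsLemma (suc k) (suc n C suc k) p-prime
           (divides (n C k) (≡.trans ([k+1]*[n+1]C[k+1]≡[n+1]*nCk n k) (ℕₚ.*-comm (suc n) (n C k))))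
  ... | inj₂ p∣pCk = p∣pCk
  ... | inj₁ p∣k   = ⊥-elim (ℕₚ.<⇒≱ (s≤s k<n) (∣⇒≤ p∣k))

-- Polynomials as coefficient lists

module Polynomial {c ℓ : Level} (R : CommutativeRing c ℓ) where
  open CommutativeRing R
  open import Relation.Binary.Reasoning.Setoid setoid
  open import Algebra.Solver.Ring.NaturalCoefficients.Default commutativeSemiring

  infix  4 _≋_ _∣_
  infixl 6 _⊕_
  infixl 7 _⊛_

  _≋_ : Pol R → Pol R → Set ℓ
  _≋_ = _≈ₚ_ R

  _⊕_ : Pol R → Pol R → Pol R
  _⊕_ = _+ₚ_ R

  _⊛_ : Pol R → Pol R → Pol R
  _⊛_ = _*ₚ_ R

  _∣_ : Pol R → Pol R → Set (c ⊔ ℓ)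
  _∣_ = _∣ₚ_ R

  scale : Carrier → Pol R → Pol R
  scale a = map (a *_)

  shift : ℕ → Pol R → Pol R
  shift j f = replicate j 0# ++ f

  coeff : Pol R → ℕ → Carrier
  coeff []      i       = 0#
  coeff (a ∷ f) zero    = a
  coeff (a ∷ f) (suc i) = coeff f i

  ≋⇒coeff≈ : ∀ {f g} → f ≋ g → ∀ i → coeff f i ≈ coeff g i
  ≋⇒coeff≈ {[]}    {[]}    _       i       = refl
  ≋⇒coeff≈ {[]}    {b ∷ g} (e , r) zero    = sym e
  ≋⇒coeff≈ {[]}    {b ∷ g} (e , r) (suc i) = ≋⇒coeff≈ {[]} {g} r i
  ≋⇒coeff≈ {a ∷ f} {[]}    (e , r) zero    = e
  ≋⇒coeff≈ {a ∷ f} {[]}    (e , r) (suc i) = ≋⇒coeff≈ {f} {[]} r i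
  ≋⇒coeff≈ {a ∷ f} {b ∷ g} (e , r) zero    = e
  ≋⇒coeff≈ {a ∷ f} {b ∷ g} (e , r) (suc i) = ≋⇒coeff≈ {f} {g} r i

  coeff≈⇒≋ : ∀ {f g} → (∀ i → coeff f i ≈ coeff g i) → f ≋ g
  coeff≈⇒≋ {[]}    {[]}    h = tt
  coeff≈⇒≋ {[]}    {b ∷ g} h = sym (h 0) , coeff≈⇒≋ {[]} {g} (h ∘ suc)
  coeff≈⇒≋ {a ∷ f} {[]}    h = h 0 , coeff≈⇒≋ {f} {[]} (h ∘ suc)
  coeff≈⇒≋ {a ∷ f} {b ∷ g} h = h 0 , coeff≈⇒≋ {f} {g} (h ∘ suc)

  ≋-refl : ∀ {f} → f ≋ f
  ≋-refl = coeff≈⇒≋ (λ _ → refl)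

  ≋-sym : ∀ {f g} → f ≋ g → g ≋ f
  ≋-sym f≋g = coeff≈⇒≋ (λ i → sym (≋⇒coeff≈ f≋g i))

  ≋-trans : ∀ {f g h} → f ≋ g → g ≋ h → f ≋ h
  ≋-trans f≋g g≋h = coeff≈⇒≋ (λ i → trans (≋⇒coeff≈ f≋g i) (≋⇒coeff≈ g≋h i))

  coeff-⊕ : ∀ f g i → coeff (f ⊕ g) i ≈ coeff f i + coeff g i
  coeff-⊕ []      g       i       = sym (+-identityˡ _)
  coeff-⊕ (a ∷ f) []      i       = sym (+-identityʳ _)
  coeff-⊕ (a ∷ f) (b ∷ g) zero    = refl
  coeff-⊕ (a ∷ f) (b ∷ g) (suc i) = coeff-⊕ f g i

  coeff-scale : ∀ a f i → coeff (scale a f) i ≈ a * coeff f i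
  coeff-scale a []      i       = sym (zeroʳ a)
  coeff-scale a (b ∷ f) zero    = refl
  coeff-scale a (b ∷ f) (suc i) = coeff-scale a f i

  coeff-∷-⊛ : ∀ a f g i → coeff ((a ∷ f) ⊛ g) i ≈ a * coeff g i + coeff (0# ∷ f ⊛ g) i
  coeff-∷-⊛ a f g i = trans (coeff-⊕ (scale a g) (0# ∷ f ⊛ g) i) (+-congʳ (coeff-scale a g i))

  coeff₀-⊛ : ∀ f g → coeff (f ⊛ g) 0 ≈ coeff f 0 * coeff g 0
  coeff₀-⊛ []      g = sym (zeroˡ _)
  coeff₀-⊛ (a ∷ f) g = trans (coeff-∷-⊛ a f g 0) (+-identityʳ _)

  ⊕-cong : ∀ {f f′ g g′} → f ≋ f′ → g ≋ g′ → f ⊕ g ≋ f′ ⊕ g′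
  ⊕-cong {f} {f′} {g} {g′} f≋f′ g≋g′ = coeff≈⇒≋ λ i → begin
    coeff (f ⊕ g) i         ≈⟨ coeff-⊕ f g i ⟩
    coeff f i + coeff g i   ≈⟨ +-cong (≋⇒coeff≈ f≋f′ i) (≋⇒coeff≈ g≋g′ i) ⟩
    coeff f′ i + coeff g′ i ≈⟨ coeff-⊕ f′ g′ i ⟨
    coeff (f′ ⊕ g′) i       ∎

  scale-congʳ : ∀ a {f g} → f ≋ g → scale a f ≋ scale a g
  scale-congʳ a {f} {g} f≋g = coeff≈⇒≋ λ i → begin
    coeff (scale a f) i ≈⟨ coeff-scale a f i ⟩
    a * coeff f i       ≈⟨ *-congˡ (≋⇒coeff≈ f≋g i) ⟩
    a * coeff g i       ≈⟨ coeff-scale a g i ⟨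
    coeff (scale a g) i ∎

  shift-cong : ∀ j {f g} → f ≋ g → shift j f ≋ shift j g
  shift-cong zero    f≋g = f≋g
  shift-cong (suc j) f≋g = refl , shift-cong j f≋g

  ⊛-zeroʳ : ∀ f → f ⊛ [] ≋ []
  ⊛-zeroʳ []      = tt
  ⊛-zeroʳ (a ∷ f) = refl , ⊛-zeroʳ f

  ⊛-identityʳ : ∀ f → f ⊛ oneₚ R ≋ f
  ⊛-identityʳ []      = tt
  ⊛-identityʳ (a ∷ f) = trans (+-identityʳ _) (*-identityʳ a) , ⊛-identityʳ f

  ⊛-identityˡ : ∀ g → oneₚ R ⊛ g ≋ g
  ⊛-identityˡ g = coeff≈⇒≋ λ i →
    trans (coeff-∷-⊛ 1# [] g i) (trans (+-cong (*-identityˡ _) (coeff-0∷[] i)) (+-identityʳ _))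
    where
    coeff-0∷[] : ∀ i → coeff (0# ∷ []) i ≈ 0#
    coeff-0∷[] zero    = refl
    coeff-0∷[] (suc i) = refl

  zero∷-⊛ : ∀ {a} f g → a ≈ 0# → (a ∷ f) ⊛ g ≋ 0# ∷ f ⊛ g
  zero∷-⊛ {a} f g a≈0 = coeff≈⇒≋ λ i → begin
    coeff ((a ∷ f) ⊛ g) i                ≈⟨ coeff-∷-⊛ a f g i ⟩
    a * coeff g i + coeff (0# ∷ f ⊛ g) i ≈⟨ +-congʳ (trans (*-congʳ a≈0) (zeroˡ _)) ⟩
    0# + coeff (0# ∷ f ⊛ g) i            ≈⟨ +-identityˡ _ ⟩
    coeff (0# ∷ f ⊛ g) i                 ∎

  ⊛-zeroˡ : ∀ {f} g → f ≋ [] → f ⊛ g ≋ []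
  ⊛-zeroˡ {[]}    g _           = tt
  ⊛-zeroˡ {a ∷ f} g (a≈0 , f≋0) = ≋-trans (zero∷-⊛ f g a≈0) (refl , ⊛-zeroˡ g f≋0)

  Xpow-⊛ : ∀ j g → Xpow R j ⊛ g ≋ shift j g
  Xpow-⊛ zero    g = ⊛-identityˡ g
  Xpow-⊛ (suc j) g = ≋-trans (zero∷-⊛ (Xpow R j) g refl) (refl , Xpow-⊛ j g)

  ⊛-distribˡ-⊕ : ∀ f g h → f ⊛ (g ⊕ h) ≋ f ⊛ g ⊕ f ⊛ h
  ⊛-distribˡ-⊕ []      g h = tt
  ⊛-distribˡ-⊕ (a ∷ f) g h = coeff≈⇒≋ λ i → begin
    coeff ((a ∷ f) ⊛ (g ⊕ h)) i
      ≈⟨ coeff-∷-⊛ a f (g ⊕ h) i ⟩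
    a * coeff (g ⊕ h) i + coeff (0# ∷ f ⊛ (g ⊕ h)) i
      ≈⟨ +-cong (*-congˡ (coeff-⊕ g h i)) (tail i) ⟩
    a * (coeff g i + coeff h i) + (coeff (0# ∷ f ⊛ g) i + coeff (0# ∷ f ⊛ h) i)
      ≈⟨ solve 5 (λ a x y u v → a :* (x :+ y) :+ (u :+ v) := (a :* x :+ u) :+ (a :* y :+ v)) refl
           a (coeff g i) (coeff h i) (coeff (0# ∷ f ⊛ g) i) (coeff (0# ∷ f ⊛ h) i) ⟩
    (a * coeff g i + coeff (0# ∷ f ⊛ g) i) + (a * coeff h i + coeff (0# ∷ f ⊛ h) i)
      ≈⟨ +-cong (coeff-∷-⊛ a f g i) (coeff-∷-⊛ a f h i) ⟨
    coeff ((a ∷ f) ⊛ g) i + coeff ((a ∷ f) ⊛ h) i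
      ≈⟨ coeff-⊕ ((a ∷ f) ⊛ g) ((a ∷ f) ⊛ h) i ⟨
    coeff ((a ∷ f) ⊛ g ⊕ (a ∷ f) ⊛ h) i ∎
    where
    tail : ∀ i → coeff (0# ∷ f ⊛ (g ⊕ h)) i ≈ coeff (0# ∷ f ⊛ g) i + coeff (0# ∷ f ⊛ h) i
    tail zero    = sym (+-identityʳ 0#)
    tail (suc i) = trans (≋⇒coeff≈ (⊛-distribˡ-⊕ f g h) i) (coeff-⊕ (f ⊛ g) (f ⊛ h) i)

  ⊛-scale : ∀ f b g → f ⊛ scale b g ≋ scale b (f ⊛ g)
  ⊛-scale []      b g = tt
  ⊛-scale (a ∷ f) b g = coeff≈⇒≋ λ i → begin
    coeff ((a ∷ f) ⊛ scale b g) i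
      ≈⟨ coeff-∷-⊛ a f (scale b g) i ⟩
    a * coeff (scale b g) i + coeff (0# ∷ f ⊛ scale b g) i
      ≈⟨ +-cong (*-congˡ (coeff-scale b g i)) (tail i) ⟩
    a * (b * coeff g i) + b * coeff (0# ∷ f ⊛ g) i
      ≈⟨ solve 4 (λ a b x u → a :* (b :* x) :+ b :* u := b :* (a :* x :+ u)) refl
           a b (coeff g i) (coeff (0# ∷ f ⊛ g) i) ⟩
    b * (a * coeff g i + coeff (0# ∷ f ⊛ g) i)
      ≈⟨ *-congˡ (coeff-∷-⊛ a f g i) ⟨
    b * coeff ((a ∷ f) ⊛ g) i
      ≈⟨ coeff-scale b ((a ∷ f) ⊛ g) i ⟨
    coeff (scale b ((a ∷ f) ⊛ g)) i ∎
    where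
    tail : ∀ i → coeff (0# ∷ f ⊛ scale b g) i ≈ b * coeff (0# ∷ f ⊛ g) i
    tail zero    = sym (zeroʳ b)
    tail (suc i) = trans (≋⇒coeff≈ (⊛-scale f b g) i) (coeff-scale b (f ⊛ g) i)

  ⊛-shift : ∀ f j g → f ⊛ shift j g ≋ shift j (f ⊛ g)
  ⊛-shift f zero    g = ≋-refl
  ⊛-shift f (suc j) g = ≋-trans (⊛-0∷ f (shift j g)) (refl , ⊛-shift f j g)
    where
    ⊛-0∷ : ∀ f g → f ⊛ (0# ∷ g) ≋ 0# ∷ f ⊛ g
    ⊛-0∷ []      g = refl , tt
    ⊛-0∷ (a ∷ f) g = trans (+-identityʳ _) (zeroʳ a) , ⊕-cong ≋-refl (⊛-0∷ f g)

  ∣-respʳ : ∀ {d f g} → f ≋ g → d ∣ f → d ∣ g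
  ∣-respʳ f≋g (e , de≋f) = e , ≋-trans de≋f f≋g

  ∣-refl : ∀ {d} → d ∣ d
  ∣-refl {d} = oneₚ R , ⊛-identityʳ d

  ∣-zero : ∀ {d f} → f ≋ [] → d ∣ f
  ∣-zero {d} f≋0 = [] , ≋-trans (⊛-zeroʳ d) (≋-sym f≋0)

  ∣-⊕ : ∀ {d f g} → d ∣ f → d ∣ g → d ∣ f ⊕ g
  ∣-⊕ {d} (e₁ , de₁≋f) (e₂ , de₂≋g) =
    e₁ ⊕ e₂ , ≋-trans (⊛-distribˡ-⊕ d e₁ e₂) (⊕-cong de₁≋f de₂≋g)

  ∣-scale : ∀ {d f} b → d ∣ f → d ∣ scale b f
  ∣-scale {d} b (e , de≋f) = scale b e , ≋-trans (⊛-scale d b e) (scale-congʳ b de≋f)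

  ∣-shift : ∀ {d f} j → d ∣ f → d ∣ shift j f
  ∣-shift {d} j (e , de≋f) = shift j e , ≋-trans (⊛-shift d j e) (shift-cong j de≋f)

  T∣-if-coeff₀≈0 : ∀ f → coeff f 0 ≈ 0# → Xpow R 1 ∣ f
  T∣-if-coeff₀≈0 []      _      = [] , ⊛-zeroʳ (Xpow R 1)
  T∣-if-coeff₀≈0 (a ∷ f) a≈0 =
    f , ≋-trans {Xpow R 1 ⊛ f} (zero∷-⊛ (oneₚ R) f refl) (sym a≈0 , ⊛-identityˡ f)

  coeff₀≈0⇒¬coprime : ¬ 1# ≈ 0# → ∀ {f g} → coeff f 0 ≈ 0# → coeff g 0 ≈ 0# →
    ¬ CoprimePol R f g
  coeff₀≈0⇒¬coprime 1≉0 {f} {g} f₀≈0 g₀≈0 coprime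
    with coprime (Xpow R 1) (T∣-if-coeff₀≈0 f f₀≈0) (T∣-if-coeff₀≈0 g g₀≈0)
  ... | e , Te≋1 = 1≉0 (begin
    1#                            ≈⟨ ≋⇒coeff≈ {Xpow R 1 ⊛ e} {oneₚ R} Te≋1 0 ⟨
    coeff (Xpow R 1 ⊛ e) 0        ≈⟨ coeff₀-⊛ (Xpow R 1) e ⟩
    0# * coeff e 0                ≈⟨ zeroˡ _ ⟩
    0#                            ∎)

  coeff₀-Xpow : ∀ {j} → 1 ≤ j → coeff (Xpow R j) 0 ≈ 0#
  coeff₀-Xpow {suc j} _ = refl

  coeff₀-XpowMinusOne : ∀ {N} → 1 ≤ N → coeff (XpowMinusOne R N) 0 ≈ - 1#
  coeff₀-XpowMinusOne {suc N} _ = +-identityˡ _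

  eval-at-0 : ∀ f → eval R f 0# ≈ coeff f 0
  eval-at-0 []      = refl
  eval-at-0 (a ∷ f) = trans (+-congˡ (zeroˡ _)) (+-identityʳ _)

-- Evaluation along a ring homomorphism

module Evaluation {c ℓ c′ ℓ′ : Level} (R : CommutativeRing c ℓ) (S : CommutativeRing c′ ℓ′)
  {h : CommutativeRing.Carrier R → CommutativeRing.Carrier S}
  (h-hom : IsRingHomomorphism (CommutativeRing.rawRing R) (CommutativeRing.rawRing S) h) where
  private module R = CommutativeRing R
  open Polynomial R using (_≋_; _⊕_; _⊛_; _∣_; scale; shift; coeff)
  open CommutativeRing S
  open IsRingHomomorphism h-hom
  open import Relation.Binary.Reasoning.Setoid setoid
  open import Algebra.Solver.Ring.NaturalCoefficients.Default commutativeSemiring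
  open import Algebra.Properties.Ring ring using (-0#≈0#; -‿+-comm; -‿distribʳ-*)

  ev : Pol R → Carrier → Carrier
  ev f = eval S (map h f)

  ev-cong : ∀ {f g} → f ≋ g → ∀ x → ev f x ≈ ev g x
  ev-cong {[]}    {[]}    _       x = refl
  ev-cong {[]}    {b ∷ g} (e , r) x = sym (trans
    (+-cong (trans (⟦⟧-cong e) 0#-homo) (*-congˡ (sym (ev-cong {[]} {g} r x))))
    (trans (+-identityˡ _) (zeroʳ x)))
  ev-cong {a ∷ f} {[]}    (e , r) x = trans
    (+-cong (trans (⟦⟧-cong e) 0#-homo) (*-congˡ (ev-cong {f} {[]} r x)))
    (trans (+-identityˡ _) (zeroʳ x))
  ev-cong {a ∷ f} {b ∷ g} (e , r) x = +-cong (⟦⟧-cong e) (*-congˡ (ev-cong {f} {g} r x))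

  ev-⊕ : ∀ f g x → ev (f ⊕ g) x ≈ ev f x + ev g x
  ev-⊕ []      g       x = sym (+-identityˡ _)
  ev-⊕ (a ∷ f) []      x = sym (+-identityʳ _)
  ev-⊕ (a ∷ f) (b ∷ g) x = begin
    h (a R.+ b) + x * ev (f ⊕ g) x      ≈⟨ +-cong (+-homo a b) (*-congˡ (ev-⊕ f g x)) ⟩
    (h a + h b) + x * (ev f x + ev g x)
      ≈⟨ solve 5 (λ u v x p q → (u :+ v) :+ x :* (p :+ q) := (u :+ x :* p) :+ (v :+ x :* q)) refl
           (h a) (h b) x (ev f x) (ev g x) ⟩
    (h a + x * ev f x) + (h b + x * ev g x) ∎

  ev-scale : ∀ a f x → ev (scale a f) x ≈ h a * ev f x
  ev-scale a []      x = sym (zeroʳ _)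
  ev-scale a (b ∷ f) x = begin
    h (a R.* b) + x * ev (scale a f) x ≈⟨ +-cong (*-homo a b) (*-congˡ (ev-scale a f x)) ⟩
    h a * h b + x * (h a * ev f x)
      ≈⟨ solve 4 (λ u v x p → u :* v :+ x :* (u :* p) := u :* (v :+ x :* p)) refl (h a) (h b) x (ev f x) ⟩
    h a * (h b + x * ev f x)           ∎

  ev-⊛ : ∀ f g x → ev (f ⊛ g) x ≈ ev f x * ev g x
  ev-⊛ []      g x = sym (zeroˡ _)
  ev-⊛ (a ∷ f) g x = begin
    ev (scale a g ⊕ (R.0# ∷ f ⊛ g)) x              ≈⟨ ev-⊕ (scale a g) (R.0# ∷ f ⊛ g) x ⟩
    ev (scale a g) x + (h R.0# + x * ev (f ⊛ g) x)
      ≈⟨ +-cong (ev-scale a g x) (+-cong 0#-homo (*-congˡ (ev-⊛ f g x))) ⟩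
    h a * ev g x + (0# + x * (ev f x * ev g x))
      ≈⟨ solve 4 (λ u G x F → u :* G :+ (con 0 :+ x :* (F :* G)) := (u :+ x :* F) :* G) refl
           (h a) (ev g x) x (ev f x) ⟩
    (h a + x * ev f x) * ev g x                    ∎

  ev-neg : ∀ f x → ev (-ₚ_ R f) x ≈ - ev f x
  ev-neg []      x = sym -0#≈0#
  ev-neg (a ∷ f) x = begin
    h (R.- a) + x * ev (-ₚ_ R f) x ≈⟨ +-cong (-‿homo a) (*-congˡ (ev-neg f x)) ⟩
    - h a + x * - ev f x           ≈⟨ +-congˡ (sym (-‿distribʳ-* x (ev f x))) ⟩
    - h a + - (x * ev f x)         ≈⟨ -‿+-comm (h a) (x * ev f x) ⟩
    - (h a + x * ev f x)           ∎

  ev-shift : ∀ j f x → ev (shift j f) x ≈ pow S x j * ev f x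
  ev-shift zero    f x = sym (*-identityˡ _)
  ev-shift (suc j) f x = begin
    h R.0# + x * ev (shift j f) x ≈⟨ +-cong 0#-homo (*-congˡ (ev-shift j f x)) ⟩
    0# + x * (pow S x j * ev f x) ≈⟨ trans (+-identityˡ _) (sym (*-assoc _ _ _)) ⟩
    x * pow S x j * ev f x        ∎

  ev-one : ∀ x → ev (oneₚ R) x ≈ 1#
  ev-one x = trans (+-cong 1#-homo (zeroʳ x)) (+-identityʳ _)

  ev-Xpow : ∀ j x → ev (Xpow R j) x ≈ pow S x j
  ev-Xpow j x = trans (ev-shift j (oneₚ R) x) (trans (*-congˡ (ev-one x)) (*-identityʳ _))

  ev-XpowMinusOne : ∀ N x → ev (XpowMinusOne R N) x ≈ pow S x N - 1#
  ev-XpowMinusOne N x = trans (ev-⊕ (Xpow R N) (-ₚ_ R (oneₚ R)) x)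
    (+-cong (ev-Xpow N x) (trans (ev-neg (oneₚ R) x) (-‿cong (ev-one x))))

  ev-at-0 : ∀ f {x} → x ≈ 0# → ev f x ≈ h (coeff f 0)
  ev-at-0 []      x≈0 = sym 0#-homo
  ev-at-0 (a ∷ f) x≈0 = trans (+-congˡ (trans (*-congʳ x≈0) (zeroˡ _))) (+-identityʳ _)

  ev-∣ : ∀ {d f} → d ∣ f → ∀ {x} → ev d x ≈ 0# → ev f x ≈ 0#
  ev-∣ {d} {f} (e , de≋f) {x} d[x]≈0 = begin
    ev f x          ≈⟨ ev-cong de≋f x ⟨
    ev (d ⊛ e) x    ≈⟨ ev-⊛ d e x ⟩
    ev d x * ev e x ≈⟨ *-congʳ d[x]≈0 ⟩
    0# * ev e x     ≈⟨ zeroˡ _ ⟩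
    0#              ∎

-- Ring homomorphisms, fields, finite fields

module RingHomomorphism {c ℓ c′ ℓ′ : Level} (R : CommutativeRing c ℓ) (S : CommutativeRing c′ ℓ′)
  {h : CommutativeRing.Carrier R → CommutativeRing.Carrier S}
  (h-hom : IsRingHomomorphism (CommutativeRing.rawRing R) (CommutativeRing.rawRing S) h) where
  private module R = CommutativeRing R
  open CommutativeRing S
  open IsRingHomomorphism h-hom
  open import Algebra.Definitions.RawMonoid R.+-rawMonoid using () renaming (_×_ to _·ᴿ_)
  open import Algebra.Definitions.RawMonoid +-rawMonoid using () renaming (_×_ to _·_)
  open import Relation.Binary.Reasoning.Setoid setoid

  ·1#-homo : ∀ n → h (n ·ᴿ R.1#) ≈ n · 1#
  ·1#-homo zero    = 0#-homo
  ·1#-homo (suc n) = trans (+-homo R.1# (n ·ᴿ R.1#)) (+-cong 1#-homo (·1#-homo n))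

  reflects-0 : IsField R → (∀ x → Dec (x R.≈ R.0#)) → ¬ 1# ≈ 0# → ∀ x → h x ≈ 0# → x R.≈ R.0#
  reflects-0 R-field _≈0? 1≉0 x hx≈0 with x ≈0?
  ... | yes x≈0 = x≈0
  ... | no  x≉0 with IsField.inverse R-field x x≉0
  ...   | y , xy≈1 = ⊥-elim (1≉0 (begin
    1#          ≈⟨ 1#-homo ⟨
    h R.1#      ≈⟨ ⟦⟧-cong (R.sym xy≈1) ⟩
    h (x R.* y) ≈⟨ *-homo x y ⟩
    h x * h y   ≈⟨ *-congʳ hx≈0 ⟩
    0# * h y    ≈⟨ zeroˡ _ ⟩
    0#          ∎))

module Power {c ℓ : Level} (K : CommutativeRing c ℓ) where
  open CommutativeRing K
  open import Algebra.Properties.Semiring.Exp semiring using (^-assocʳ; ^-congˡ) renaming (_^_ to _^ᴷ_)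

  pow≡^ : ∀ x n → pow K x n ≡ x ^ᴷ n
  pow≡^ x zero    = ≡.refl
  pow≡^ x (suc n) = ≡.cong (x *_) (pow≡^ x n)

  pow-congˡ : ∀ {x y} n → x ≈ y → pow K x n ≈ pow K y n
  pow-congˡ zero    x≈y = refl
  pow-congˡ (suc n) x≈y = *-cong x≈y (pow-congˡ n x≈y)

  pow-assocʳ : ∀ x m n → pow K (pow K x m) n ≈ pow K x (m ℕ.* n)
  pow-assocʳ x m n = begin
    pow K (pow K x m) n ≈⟨ reflexive (pow≡^ (pow K x m) n) ⟩
    pow K x m ^ᴷ n       ≈⟨ ^-congˡ n (reflexive (pow≡^ x m)) ⟩
    (x ^ᴷ m) ^ᴷ n         ≈⟨ ^-assocʳ x m n ⟩
    x ^ᴷ (m ℕ.* n)       ≈⟨ reflexive (≡.sym (pow≡^ x (m ℕ.* n))) ⟩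
    pow K x (m ℕ.* n)   ∎
    where open import Relation.Binary.Reasoning.Setoid setoid

  pow-1# : ∀ n → pow K 1# n ≈ 1#
  pow-1# zero    = refl
  pow-1# (suc n) = trans (*-identityˡ _) (pow-1# n)

module FieldProperties {c ℓ : Level} {K : CommutativeRing c ℓ} (K-field : IsField K) where
  open CommutativeRing K
  open IsField K-field
  open Power K using (pow-congˡ)
  open import Relation.Binary.Reasoning.Setoid setoid

  x*y≈0⇒y≈0 : ∀ {x y} → ¬ x ≈ 0# → x * y ≈ 0# → y ≈ 0#
  x*y≈0⇒y≈0 {x} {y} x≉0 xy≈0 with inverse x x≉0
  ... | z , xz≈1 = begin
    y           ≈⟨ *-identityˡ y ⟨
    1# * y      ≈⟨ *-congʳ xz≈1 ⟨
    (x * z) * y ≈⟨ *-congʳ (*-comm x z) ⟩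
    (z * x) * y ≈⟨ *-assoc z x y ⟩
    z * (x * y) ≈⟨ *-congˡ xy≈0 ⟩
    z * 0#      ≈⟨ zeroʳ z ⟩
    0#          ∎

  pow-nonzero : ∀ {x} → ¬ x ≈ 0# → ∀ n → ¬ pow K x n ≈ 0#
  pow-nonzero x≉0 zero    = 1≉0
  pow-nonzero x≉0 (suc n) xxⁿ≈0 = pow-nonzero x≉0 n (x*y≈0⇒y≈0 x≉0 xxⁿ≈0)

  root-of-unity-nonzero : ∀ {x n} → 1 ≤ n → pow K x n ≈ 1# → ¬ x ≈ 0#
  root-of-unity-nonzero {x} {suc n} _ xⁿ≈1 x≈0 = 1≉0 (begin
    1#                ≈⟨ xⁿ≈1 ⟨
    pow K x (suc n)   ≈⟨ pow-congˡ (suc n) x≈0 ⟩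
    pow K 0# (suc n)  ≈⟨ zeroˡ _ ⟩
    0#                ∎)

module FiniteRing {c ℓ : Level} (F : CommutativeRing c ℓ) {q : ℕ} (card : HasCard F q) where
  open CommutativeRing F
  open import Algebra.Definitions.RawMonoid +-rawMonoid using () renaming (_×_ to _·_)
  open import Algebra.Properties.CommutativeMonoid.Sum +-commutativeMonoid
    using (sum; sum-permute; sum-cong-≋; ∑-distrib-+; sum-replicate)
  open import Algebra.Properties.Semiring.Mult semiring using (×1-homo-*)
  open import Algebra.Properties.Group +-group using (identityˡ-unique)
  open import Data.Fin.Permutation using (permutation)
  import Data.Fin as Fin
  import Data.Vec.Functional as Vector
  open import Relation.Binary.Reasoning.Setoid setoid

  private
    enum : Fin q → Carrier
    enum = proj₁ card

    enum-injective : ∀ i j → enum i ≈ enum j → i ≡ j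
    enum-injective = proj₁ (proj₂ card)

    index : Carrier → Fin q
    index x = proj₁ (proj₂ (proj₂ card) x)

    enum-index : ∀ x → enum (index x) ≈ x
    enum-index x = proj₂ (proj₂ (proj₂ card) x)

  _≈?_ : ∀ x y → Dec (x ≈ y)
  x ≈? y with index x Fin.≟ index y
  ... | yes i≡j = yes (trans (sym (enum-index x)) (trans (reflexive (≡.cong enum i≡j)) (enum-index y)))
  ... | no  i≢j = no (λ x≈y → i≢j (enum-injective _ _
                        (trans (enum-index x) (trans x≈y (sym (enum-index y))))))

  -- translation by x permutes the elements, so Σ y = Σ (x + y) = q · x + Σ y
  q·x≈0 : ∀ x → q · x ≈ 0#
  q·x≈0 x = identityˡ-unique (q · x) S (sym S≈q·x+S)
    where
    S : Carrier
    S = sum enum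
    translate : Fin q → Fin q
    translate i = index (x + enum i)
    untranslate : Fin q → Fin q
    untranslate j = index (enum j - x)
    translate-untranslate : ∀ j → translate (untranslate j) ≡ j
    translate-untranslate j = enum-injective _ _ (begin
      enum (translate (untranslate j)) ≈⟨ enum-index _ ⟩
      x + enum (untranslate j)         ≈⟨ +-congˡ (enum-index _) ⟩
      x + (enum j - x)                 ≈⟨ +-comm x _ ⟩
      (enum j - x) + x                 ≈⟨ +-assoc _ _ _ ⟩
      enum j + (- x + x)               ≈⟨ +-congˡ (-‿inverseˡ x) ⟩
      enum j + 0#                      ≈⟨ +-identityʳ _ ⟩
      enum j                           ∎)
    untranslate-translate : ∀ i → untranslate (translate i) ≡ i
    untranslate-translate i = enum-injective _ _ (begin
      enum (untranslate (translate i)) ≈⟨ enum-index _ ⟩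
      enum (translate i) - x           ≈⟨ +-congʳ (enum-index _) ⟩
      (x + enum i) - x                 ≈⟨ +-congʳ (+-comm x _) ⟩
      (enum i + x) - x                 ≈⟨ +-assoc _ _ _ ⟩
      enum i + (x - x)                 ≈⟨ +-congˡ (-‿inverseʳ x) ⟩
      enum i + 0#                      ≈⟨ +-identityʳ _ ⟩
      enum i                           ∎)
    S≈q·x+S : S ≈ q · x + S
    S≈q·x+S = begin
      S                              ≈⟨ sum-permute enum (permutation translate untranslate
                                           translate-untranslate untranslate-translate) ⟩
      sum (λ i → enum (translate i)) ≈⟨ sum-cong-≋ (λ i → enum-index (x + enum i)) ⟩
      sum (λ i → x + enum i)         ≈⟨ ∑-distrib-+ (λ _ → x) enum ⟩
      sum (Vector.replicate q x) + S ≈⟨ +-congʳ (sum-replicate q) ⟩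
      q · x + S                      ∎

  ·1-pow : ∀ p j → (p ^ j) · 1# ≈ pow F (p · 1#) j
  ·1-pow p zero    = +-identityʳ _
  ·1-pow p (suc j) = trans (×1-homo-* p (p ^ j)) (*-congˡ (·1-pow p j))

  card≡p^e⇒p·1≈0 : IsField F → ∀ {p e} → q ≡ p ^ e → p · 1# ≈ 0#
  card≡p^e⇒p·1≈0 F-field {p} {e} q≡pᵉ with (p · 1#) ≈? 0#
  ... | yes p·1≈0 = p·1≈0
  ... | no  p·1≉0 = ⊥-elim (FieldProperties.pow-nonzero F-field p·1≉0 e (begin
    pow F (p · 1#) e ≈⟨ ·1-pow p e ⟨
    (p ^ e) · 1#     ≡⟨ ≡.cong (_· 1#) q≡pᵉ ⟨
    q · 1#           ≈⟨ q·x≈0 1# ⟩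
    0#               ∎))

-- The Frobenius map

module Frobenius {c ℓ : Level} (K : CommutativeRing c ℓ) where
  open CommutativeRing K
  open import Algebra.Definitions.RawMonoid +-rawMonoid using () renaming (_×_ to _·_)
  open import Algebra.Properties.Semiring.Exp semiring using () renaming (_^_ to _^ᴷ_)
  open import Algebra.Properties.Semiring.Mult semiring using (×-congʳ; ×-assoc-*; ×1-homo-*)
  open import Algebra.Properties.CommutativeSemiring.Binomial commutativeSemiring using (theorem; binomialTerm)
  open import Algebra.Properties.Monoid.Sum +-monoid using (sum; sum-init-last; sum-cong-≋; sum-replicate-zero)
  open import Algebra.Properties.Group +-group using (identityˡ-unique; x∙y⁻¹≈ε⇒x≈y)
  open import Relation.Binary.Reasoning.Setoid setoid
  import Data.Vec.Functional as Vector
  open Power K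

  inner-binomialTerm≈0 : ∀ {p} → Prime p → p · 1# ≈ 0# →
    ∀ z (k : Fin (suc p)) → 0 < toℕ k → toℕ k < p → binomialTerm z 1# p k ≈ 0#
  inner-binomialTerm≈0 {p} p-prime char z k 0<k k<p with prime∣pCk p-prime 0<k k<p
  ... | divides t pCk≡t*p = begin
    (p C toℕ k) · w              ≡⟨ ≡.cong (_· w) pCk≡t*p ⟩
    (t ℕ.* p) · w                ≈⟨ ×-congʳ (t ℕ.* p) (*-identityˡ w) ⟨
    (t ℕ.* p) · (1# * w)         ≈⟨ ×-assoc-* (t ℕ.* p) 1# w ⟨
    ((t ℕ.* p) · 1#) * w         ≈⟨ *-congʳ (×1-homo-* t p) ⟩
    ((t · 1#) * (p · 1#)) * w    ≈⟨ *-congʳ (trans (*-congˡ char) (zeroʳ _)) ⟩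
    0# * w                       ≈⟨ zeroˡ w ⟩
    0#                           ∎
    where w = z ^ᴷ toℕ k * 1# ^ᴷ (p ∸ toℕ k)

  frobenius-+1 : ∀ {p} → Prime p → p · 1# ≈ 0# → ∀ z → pow K (z + 1#) p ≈ pow K z p + 1#
  frobenius-+1 {0}           p-prime = ⊥-elim (¬prime[0] p-prime)
  frobenius-+1 {1}           p-prime = ⊥-elim (¬prime[1] p-prime)
  frobenius-+1 {suc (suc r)} p-prime char z = begin
    pow K (z + 1#) p                              ≡⟨ pow≡^ (z + 1#) p ⟩
    (z + 1#) ^ᴷ p                                 ≈⟨ theorem p z 1# ⟩
    t fzero + sum (Vector.tail t)                 ≈⟨ +-cong first (sum-init-last (Vector.tail t)) ⟩
    1# + (sum (Vector.init (Vector.tail t)) + Vector.last (Vector.tail t))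
                                                  ≈⟨ +-congˡ (+-cong inner last) ⟩
    1# + (0# + z ^ᴷ p)                            ≈⟨ trans (+-congˡ (+-identityˡ _)) (+-comm _ _) ⟩
    z ^ᴷ p + 1#                                   ≡⟨ ≡.cong (_+ 1#) (pow≡^ z p) ⟨
    pow K z p + 1#                                ∎
    where
    p = suc (suc r)
    t = binomialTerm z 1# p
    1^ : ∀ n → 1# ^ᴷ n ≈ 1#
    1^ n = trans (reflexive (≡.sym (pow≡^ 1# n))) (pow-1# n)
    first : t fzero ≈ 1#
    first = trans (+-identityʳ _) (trans (*-identityˡ _) (1^ p))
    top : ∀ k → toℕ k ≡ p → t k ≈ z ^ᴷ p
    top k k≡p rewrite k≡p | nCn≡1 p | ℕₚ.n∸n≡0 p = trans (+-identityʳ _) (*-identityʳ _)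
    last : Vector.last (Vector.tail t) ≈ z ^ᴷ p
    last = top (fromℕ p) (Finₚ.toℕ-fromℕ p)
    inner : sum (Vector.init (Vector.tail t)) ≈ 0#
    inner = trans (sum-cong-≋ {suc r} {Vector.init (Vector.tail t)} {Vector.replicate (suc r) 0#}
                    (λ i → inner-binomialTerm≈0 p-prime char z (fsuc (inject₁ i)) (s≤s z≤n)
                      (s≤s (≡.subst (_< suc r) (≡.sym (Finₚ.toℕ-inject₁ i)) (Finₚ.toℕ<n i)))))
                  (sum-replicate-zero (suc r))

  frobenius-+1-iterate : ∀ {p} → Prime p → p · 1# ≈ 0# →
    ∀ n z → pow K (z + 1#) (p ^ n) ≈ pow K z (p ^ n) + 1#
  frobenius-+1-iterate {p} p-prime char zero    z = trans (*-identityʳ _) (+-congʳ (sym (*-identityʳ _)))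
  frobenius-+1-iterate {p} p-prime char (suc n) z = begin
    pow K (z + 1#) (p ℕ.* p ^ n)     ≈⟨ pow-assocʳ (z + 1#) p (p ^ n) ⟨
    pow K (pow K (z + 1#) p) (p ^ n) ≈⟨ pow-congˡ (p ^ n) (frobenius-+1 p-prime char z) ⟩
    pow K (pow K z p + 1#) (p ^ n)   ≈⟨ frobenius-+1-iterate p-prime char n (pow K z p) ⟩
    pow K (pow K z p) (p ^ n) + 1#   ≈⟨ +-congʳ (pow-assocʳ z p (p ^ n)) ⟩
    pow K z (p ℕ.* p ^ n) + 1#       ∎

  -- injectivity of y ↦ y^(p^n) at 1, stated contrapositively: without decidable
  -- equality in K one cannot conclude y ≈ 1 from (y - 1)^(p^n) ≈ 0
  ≉1⇒pow-p^n≉1 : IsField K → ∀ {p} → Prime p → p · 1# ≈ 0# →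
    ∀ n {y} → ¬ y ≈ 1# → ¬ pow K y (p ^ n) ≈ 1#
  ≉1⇒pow-p^n≉1 K-field {p} p-prime char n {y} y≉1 yᵖⁿ≈1 =
    FieldProperties.pow-nonzero K-field (λ y-1≈0 → y≉1 (x∙y⁻¹≈ε⇒x≈y y 1# y-1≈0)) (p ^ n)
      (identityˡ-unique _ 1# (begin
        pow K (y - 1#) (p ^ n) + 1# ≈⟨ frobenius-+1-iterate p-prime char n (y - 1#) ⟨
        pow K (y - 1# + 1#) (p ^ n) ≈⟨ pow-congˡ (p ^ n) y-1+1≈y ⟩
        pow K y (p ^ n)             ≈⟨ yᵖⁿ≈1 ⟩
        1#                          ∎))
    where
    y-1+1≈y : y - 1# + 1# ≈ y
    y-1+1≈y = trans (+-assoc _ _ _) (trans (+-congˡ (-‿inverseˡ 1#)) (+-identityʳ y))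

-- Common divisors and common roots

module ConstantTermEuclid {c ℓ c′ ℓ′ : Level} {F : CommutativeRing c ℓ} (F-field : IsField F)
  (_≈0? : ∀ x → Dec (CommutativeRing._≈_ F x (CommutativeRing.0# F)))
  {K : CommutativeRing c′ ℓ′} (K-field : IsField K)
  {ι : CommutativeRing.Carrier F → CommutativeRing.Carrier K}
  (ι-hom : IsRingHomomorphism (CommutativeRing.rawRing F) (CommutativeRing.rawRing K) ι) where
  open CommutativeRing F
  open Polynomial F
  private module K = CommutativeRing K
  open Evaluation F K ι-hom
  open FieldProperties K-field using (x*y≈0⇒y≈0; pow-nonzero)
  open import Algebra.Solver.Ring.NaturalCoefficients.Default commutativeSemiring using (solve; _:*_; _:=_)
  open import Algebra.Properties.Ring ring using (-‿distribˡ-*)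

  VanishesOnNonzeroCommonRoots : Pol F → Pol F → Pol F → Set (c′ ⊔ ℓ′)
  VanishesOnNonzeroCommonRoots f g d =
    ∀ x → ¬ x K.≈ K.0# → ev f x K.≈ K.0# → ev g x K.≈ K.0# → ev d x K.≈ K.0#

  CommonDivisor : Pol F → Pol F → Set (c ⊔ ℓ ⊔ c′ ⊔ ℓ′)
  CommonDivisor f g = Σ (Pol F) λ d → d ∣ f × d ∣ g × VanishesOnNonzeroCommonRoots f g d

  -- Euclid's algorithm run from the constant terms: a ∷ f = T f′ + k (b ∷ g) kills the
  -- constant term of a ∷ f.  Powers of T are discarded, which only loses the root 0.
  Reduction : Carrier → Pol F → Carrier → Pol F → Set (c ⊔ ℓ)
  Reduction a f b g = Σ (Pol F) λ f′ → length f′ ≤ length f ×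
    Σ Carrier λ k → a ∷ f ≋ (0# ∷ f′) ⊕ scale k (b ∷ g)

  reduce : ∀ a f b g → ¬ b ≈ 0# → length g ≤ length f → Reduction a f b g
  reduce a f b g b≉0 |g|≤|f| with IsField.inverse F-field b b≉0
  ... | b⁻¹ , bb⁻¹≈1 =
    f′ , |f′|≤|f| , k , coeff≈⇒≋ {a ∷ f} {(0# ∷ f′) ⊕ scale k (b ∷ g)} (λ i → sym (coeff-reduced i))
    where
    open import Relation.Binary.Reasoning.Setoid setoid
    k = a * b⁻¹
    f′ = f ⊕ scale (- k) g
    length-⊕ : ∀ f g → length g ≤ length f → length (f ⊕ g) ≤ length f
    length-⊕ []      []      _         = z≤n
    length-⊕ (a ∷ f) []      _         = ℕₚ.≤-refl
    length-⊕ (a ∷ f) (b ∷ g) (s≤s |g|≤|f|) = s≤s (length-⊕ f g |g|≤|f|)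
    |f′|≤|f| : length f′ ≤ length f
    |f′|≤|f| = length-⊕ f (scale (- k) g)
      (≡.subst (_≤ length f) (≡.sym (Data.List.Properties.length-map (- k *_) g)) |g|≤|f|)
    coeff-reduced : ∀ i → coeff ((0# ∷ f′) ⊕ scale k (b ∷ g)) i ≈ coeff (a ∷ f) i
    coeff-reduced zero = begin
      0# + k * b      ≈⟨ +-identityˡ _ ⟩
      a * b⁻¹ * b     ≈⟨ solve 3 (λ a y b → a :* y :* b := a :* (b :* y)) refl a b⁻¹ b ⟩
      a * (b * b⁻¹)   ≈⟨ *-congˡ bb⁻¹≈1 ⟩
      a * 1#          ≈⟨ *-identityʳ a ⟩
      a               ∎
    coeff-reduced (suc i) = begin
      coeff (f′ ⊕ scale k g) i                       ≈⟨ coeff-⊕ f′ (scale k g) i ⟩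
      coeff f′ i + coeff (scale k g) i               ≈⟨ +-cong (coeff-⊕ f (scale (- k) g) i) (coeff-scale k g i) ⟩
      (coeff f i + coeff (scale (- k) g) i) + k * coeff g i
        ≈⟨ +-congʳ (+-congˡ (trans (coeff-scale (- k) g i) (sym (-‿distribˡ-* k (coeff g i))))) ⟩
      (coeff f i - k * coeff g i) + k * coeff g i    ≈⟨ +-assoc _ _ _ ⟩
      coeff f i + (- (k * coeff g i) + k * coeff g i) ≈⟨ +-congˡ (-‿inverseˡ _) ⟩
      coeff f i + 0#                                 ≈⟨ +-identityʳ _ ⟩
      coeff f i                                      ∎

  reduction-∣ : ∀ {a f b g f′ k d} → a ∷ f ≋ (0# ∷ f′) ⊕ scale k (b ∷ g) →
    d ∣ f′ → d ∣ b ∷ g → d ∣ a ∷ f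
  reduction-∣ {a} {f} {b} {g} {f′} {k} {d} eq d∣f′ d∣g =
    ∣-respʳ {d} {(0# ∷ f′) ⊕ scale k (b ∷ g)} {a ∷ f} (≋-sym {a ∷ f} {(0# ∷ f′) ⊕ scale k (b ∷ g)} eq)
      (∣-⊕ {d} {0# ∷ f′} (∣-shift {d} {f′} 1 d∣f′) (∣-scale {d} {b ∷ g} k d∣g))

  reduction-root : ∀ {a f b g f′ k} → a ∷ f ≋ (0# ∷ f′) ⊕ scale k (b ∷ g) →
    VanishesOnNonzeroCommonRoots (a ∷ f) (b ∷ g) f′
  reduction-root {a} {f} {b} {g} {f′} {k} eq x x≉0 f[x]≈0 g[x]≈0 = x*y≈0⇒y≈0 x≉0 (begin
    x K.* ev f′ x                                   ≈⟨ K.+-identityˡ _ ⟨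
    K.0# K.+ x K.* ev f′ x                          ≈⟨ K.+-congʳ (IsRingHomomorphism.0#-homo ι-hom) ⟨
    ev (0# ∷ f′) x                                  ≈⟨ K.+-identityʳ _ ⟨
    ev (0# ∷ f′) x K.+ K.0#                         ≈⟨ K.+-congˡ (K.trans (K.*-congˡ g[x]≈0) (K.zeroʳ _)) ⟨
    ev (0# ∷ f′) x K.+ ι k K.* ev (b ∷ g) x         ≈⟨ K.+-congˡ (ev-scale k (b ∷ g) x) ⟨
    ev (0# ∷ f′) x K.+ ev (scale k (b ∷ g)) x       ≈⟨ ev-⊕ (0# ∷ f′) (scale k (b ∷ g)) x ⟨
    ev ((0# ∷ f′) ⊕ scale k (b ∷ g)) x              ≈⟨ ev-cong {a ∷ f} {(0# ∷ f′) ⊕ scale k (b ∷ g)} eq x ⟨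
    ev (a ∷ f) x                                    ≈⟨ f[x]≈0 ⟩
    K.0#                                            ∎)
    where
    open import Relation.Binary.Reasoning.Setoid K.setoid

  reduction-common-divisor : ∀ {a f b g f′ k} → a ∷ f ≋ (0# ∷ f′) ⊕ scale k (b ∷ g) →
    CommonDivisor f′ (b ∷ g) → CommonDivisor (a ∷ f) (b ∷ g)
  reduction-common-divisor {a} {f} {b} {g} {f′} {k} eq (d , d∣f′ , d∣g , d-roots) =
    d , reduction-∣ {a} {f} {b} {g} {f′} {k} {d} eq d∣f′ d∣g , d∣g ,
    λ x x≉0 f[x]≈0 g[x]≈0 →
      d-roots x x≉0 (reduction-root {a} {f} {b} {g} {f′} {k} eq x x≉0 f[x]≈0 g[x]≈0) g[x]≈0

  common-divisor-sym : ∀ {f g} → CommonDivisor f g → CommonDivisor g f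
  common-divisor-sym (d , d∣f , d∣g , d-roots) =
    d , d∣g , d∣f , λ x x≉0 g[x]≈0 f[x]≈0 → d-roots x x≉0 f[x]≈0 g[x]≈0

  common-divisor-unshift : ∀ {f f₁ g} j → f ≋ shift j f₁ → CommonDivisor f₁ g → CommonDivisor f g
  common-divisor-unshift {f} {f₁} {g} j f≋Tʲf₁ (d , d∣f₁ , d∣g , d-roots) =
    d , ∣-respʳ {d} {shift j f₁} {f} (≋-sym {f} {shift j f₁} f≋Tʲf₁) (∣-shift {d} {f₁} j d∣f₁) , d∣g ,
    λ x x≉0 f[x]≈0 g[x]≈0 → d-roots x x≉0 (f₁-root x x≉0 f[x]≈0) g[x]≈0
    where
    f₁-root : ∀ x → ¬ x K.≈ K.0# → ev f x K.≈ K.0# → ev f₁ x K.≈ K.0#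
    f₁-root x x≉0 f[x]≈0 = x*y≈0⇒y≈0 (pow-nonzero x≉0 j)
      (K.trans (K.sym (ev-shift j f₁ x)) (K.trans (K.sym (ev-cong {f} {shift j f₁} f≋Tʲf₁ x)) f[x]≈0))

  split-T-power : ∀ f → f ≋ [] ⊎ Σ ℕ λ j → Σ Carrier λ a → Σ (Pol F) λ f₁ →
    ¬ a ≈ 0# × f ≋ shift j (a ∷ f₁) × length f₁ < length f
  split-T-power []      = inj₁ tt
  split-T-power (a ∷ f) with a ≈0?
  ... | no a≉0 = inj₂ (0 , a , f , a≉0 , ≋-refl {a ∷ f} , ℕₚ.≤-refl)
  ... | yes a≈0 with split-T-power f
  ...   | inj₁ f≋0 = inj₁ (a≈0 , f≋0)
  ...   | inj₂ (j , a′ , f₁ , a′≉0 , f≋Tʲf₁ , |f₁|<|f|) =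
    inj₂ (suc j , a′ , f₁ , a′≉0 , (a≈0 , f≋Tʲf₁) , ℕₚ.m≤n⇒m≤1+n |f₁|<|f|)

  common-divisor-bounded : ∀ s f b g → ¬ b ≈ 0# → length f ℕ.+ length (b ∷ g) ≤ s →
    CommonDivisor f (b ∷ g)
  common-divisor-bounded zero f b g b≉0 bound =
    ⊥-elim (ℕₚ.<⇒≱ (ℕₚ.≤-trans (ℕₚ.m≤n+m (suc (length g)) (length f)) bound) z≤n)
  common-divisor-bounded (suc s) f b g b≉0 bound with split-T-power f
  ... | inj₁ f≋0 = (b ∷ g) , ∣-zero {b ∷ g} {f} f≋0 , ∣-refl {b ∷ g} , λ x _ _ g[x]≈0 → g[x]≈0
  ... | inj₂ (j , a , f₁ , a≉0 , f≋Tʲf₁ , |f₁|<|f|) =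
    common-divisor-unshift j f≋Tʲf₁ (reduce-longer (length g ℕ.≤? length f₁))
    where
    reduce-longer : Dec (length g ≤ length f₁) → CommonDivisor (a ∷ f₁) (b ∷ g)
    reduce-longer (yes |g|≤|f₁|) with reduce a f₁ b g b≉0 |g|≤|f₁|
    ... | f′ , |f′|≤|f₁| , k , eq = reduction-common-divisor {a} {f₁} {b} {g} {f′} {k} eq
      (common-divisor-bounded s f′ b g b≉0 (ℕₚ.≤-pred (ℕₚ.≤-trans
        (ℕₚ.+-monoˡ-≤ (length (b ∷ g)) (ℕₚ.≤-trans (s≤s |f′|≤|f₁|) |f₁|<|f|)) bound)))
    reduce-longer (no |g|≰|f₁|) with reduce b g a f₁ a≉0 (ℕₚ.≰⇒≥ |g|≰|f₁|)
    ... | f′ , |f′|≤|g| , k , eq = common-divisor-sym (reduction-common-divisor {b} {g} {a} {f₁} {f′} {k} eq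
      (common-divisor-bounded s f′ a f₁ a≉0 (ℕₚ.≤-pred (ℕₚ.≤-trans
        (≡.subst (_≤ length f ℕ.+ length (b ∷ g)) (ℕₚ.+-comm (length (a ∷ f₁)) (suc (length f′)))
          (ℕₚ.+-mono-≤ |f₁|<|f| (s≤s |f′|≤|g|))) bound))))

  common-divisor : ∀ f b g → ¬ b ≈ 0# → CommonDivisor f (b ∷ g)
  common-divisor f b g b≉0 = common-divisor-bounded _ f b g b≉0 ℕₚ.≤-refl

  nonzero-common-root⇒¬coprime : ∀ f g j {α} → ¬ coeff g 0 ≈ 0# → ¬ α K.≈ K.0# →
    ev f α K.≈ K.0# → ev g α K.≈ K.0# → ¬ CoprimePol F f (Xpow F j ⊛ g)
  nonzero-common-root⇒¬coprime f []      j 0≉0 = ⊥-elim (0≉0 refl)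
  nonzero-common-root⇒¬coprime f (b ∷ g) j {α} b≉0 α≉0 f[α]≈0 g[α]≈0 coprime
    with common-divisor f b g b≉0
  ... | d , d∣f , d∣g , d-roots =
    IsField.1≉0 K-field (K.trans (K.sym (ev-one α)) (ev-∣ {d} {oneₚ F} (coprime d d∣f d∣Tʲg) d[α]≈0))
    where
    d∣Tʲg : d ∣ Xpow F j ⊛ (b ∷ g)
    d∣Tʲg = ∣-respʳ {d} {shift j (b ∷ g)} (≋-sym {Xpow F j ⊛ (b ∷ g)} (Xpow-⊛ j (b ∷ g)))
              (∣-shift {d} {b ∷ g} j d∣g)
    d[α]≈0 : ev d α K.≈ K.0#
    d[α]≈0 = d-roots α α≉0 f[α]≈0 g[α]≈0

module AlgebraicClosure {c ℓ c′ ℓ′ : Level} {F : CommutativeRing c ℓ} (F-field : IsField F)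
  (_≈0? : ∀ x → Dec (CommutativeRing._≈_ F x (CommutativeRing.0# F)))
  (Fbar : AlgClosure F c′ ℓ′) where
  open CommutativeRing F
  open Polynomial F
  open AlgClosure Fbar using (K; K-field; ι; ι-hom; closed)
  private module K = CommutativeRing K
  open Evaluation F K ι-hom

  ≋[]? : ∀ f → Dec (f ≋ [])
  ≋[]? []      = yes tt
  ≋[]? (a ∷ f) with a ≈0? | ≋[]? f
  ... | yes a≈0 | yes f≋0 = yes (a≈0 , f≋0)
  ... | no  a≉0 | _       = no (a≉0 ∘ proj₁)
  ... | yes _   | no  f≉0 = no (f≉0 ∘ proj₂)

  map-ι-≋[] : ∀ f → _≈ₚ_ K (map ι f) [] → f ≋ []
  map-ι-≋[] []      _             = tt
  map-ι-≋[] (a ∷ f) (ιa≈0 , ιf≋0) =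
    RingHomomorphism.reflects-0 F K ι-hom F-field _≈0? (IsField.1≉0 K-field) a ιa≈0 , map-ι-≋[] f ιf≋0

  no-common-root⇒coprime : ∀ {f g} → ¬ f ≋ [] →
    (∀ x → ev f x K.≈ K.0# → ev g x K.≈ K.0# → ⊥) → CoprimePol F f g
  no-common-root⇒coprime {f} f≉0 no-common-root d d∣f d∣g with ≋[]? d
  ... | yes d≋0 = ⊥-elim (f≉0 (≋-trans {f} {d ⊛ proj₁ d∣f} (≋-sym {d ⊛ proj₁ d∣f} (proj₂ d∣f))
                                         (⊛-zeroˡ (proj₁ d∣f) d≋0)))
  no-common-root⇒coprime {f} f≉0 no-common-root [] d∣f d∣g | no d≉0 = ⊥-elim (d≉0 tt)
  no-common-root⇒coprime {f} f≉0 no-common-root (b ∷ d′) d∣f d∣g | no d≉0 with ≋[]? d′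
  ... | yes d′≋0 = unit (b ≈0?)
    where
    unit : Dec (b ≈ 0#) → b ∷ d′ ∣ oneₚ F
    unit (yes b≈0) = ⊥-elim (d≉0 (b≈0 , d′≋0))
    unit (no  b≉0) with IsField.inverse F-field b b≉0
    ... | b⁻¹ , bb⁻¹≈1 = b⁻¹ ∷ [] , trans (+-identityʳ _) bb⁻¹≈1 , ⊛-zeroˡ (b⁻¹ ∷ []) d′≋0
  ... | no d′≉0 with closed (ι b) (map ι d′) (d′≉0 ∘ map-ι-≋[] d′)
  ...   | x , d[x]≈0 =
    ⊥-elim (no-common-root x (ev-∣ {b ∷ d′} {f} d∣f d[x]≈0) (ev-∣ {b ∷ d′} d∣g d[x]≈0))

-- The coprimality criterion

module Criterion {c ℓ c′ ℓ′ : Level} {p q e : ℕ} (p-prime : Prime p) (q≡pᵉ : q ≡ p ^ e)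
  {F : CommutativeRing c ℓ} (F-field : IsField F) (card : HasCard F q) (Fbar : AlgClosure F c′ ℓ′)
  (A B : Pol F) {j l : ℕ} (1≤j : 1 ≤ j) (1≤l : 1 ≤ l) (n : ℕ) where
  open CommutativeRing F
  open Polynomial F
  open AlgClosure Fbar using (K; K-field; ι; ι-hom)
  private module K = CommutativeRing K
  open Evaluation F K ι-hom
  open FiniteRing F card using (_≈?_; card≡p^e⇒p·1≈0)
  open FieldProperties K-field using (x*y≈0⇒y≈0; pow-nonzero; root-of-unity-nonzero)
  open Power K using (pow-congˡ; pow-assocʳ; pow-1#)
  open import Algebra.Properties.Group +-group using (x∙y⁻¹≈ε⇒x≈y; x≈y⇒x∙y⁻¹≈ε)
  import Algebra.Properties.Group K.+-group as KG
  open import Algebra.Definitions.RawMonoid +-rawMonoid using () renaming (_×_ to _·_)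
  open import Algebra.Definitions.RawMonoid K.+-rawMonoid using () renaming (_×_ to _·ᴷ_)
  open import Relation.Binary.Reasoning.Setoid K.setoid

  N : ℕ
  N = l ℕ.* p ^ n

  X P Q : Pol F
  X = XpowMinusOne F N
  P = A ⊛ X ⊕ B
  Q = Xpow F j ⊛ X

  DistinctConstantTerms : Set ℓ
  DistinctConstantTerms = ¬ eval F A 0# ≈ eval F B 0#

  NoRootOfUnityIsRoot : Set (c′ ⊔ ℓ′)
  NoRootOfUnityIsRoot = ∀ α → pow K α l K.≈ K.1# → ¬ ev B α K.≈ K.0#

  1≤N : 1 ≤ N
  1≤N = ℕₚ.*-mono-≤ 1≤l (ℕₚ.m^n>0 p {{prime⇒nonZero p-prime}} n)

  _≈0? : ∀ x → Dec (x ≈ 0#)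
  x ≈0? = x ≈? 0#

  coeff₀-P : coeff P 0 ≈ coeff B 0 - coeff A 0
  coeff₀-P = trans (coeff-⊕ (A ⊛ X) B 0) (trans (+-congʳ (trans (coeff₀-⊛ A X)
    (trans (*-congˡ (coeff₀-XpowMinusOne 1≤N)) (trans (*-comm _ _) (-1*x≈-x _))))) (+-comm _ _))
    where open import Algebra.Properties.Ring ring using (-1*x≈-x)

  coeff₀-Q : coeff Q 0 ≈ 0#
  coeff₀-Q = trans (coeff₀-⊛ (Xpow F j) X) (trans (*-congʳ (coeff₀-Xpow 1≤j)) (zeroˡ _))

  ev-P : ∀ x → ev P x K.≈ ev A x K.* ev X x K.+ ev B x
  ev-P x = K.trans (ev-⊕ (A ⊛ X) B x) (K.+-congʳ (ev-⊛ A X x))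

  X-root⇒[P-root⇒B-root] : ∀ {x} → ev X x K.≈ K.0# → ev P x K.≈ K.0# → ev B x K.≈ K.0#
  X-root⇒[P-root⇒B-root] {x} X[x]≈0 P[x]≈0 = begin
    ev B x                              ≈⟨ K.+-identityˡ _ ⟨
    K.0# K.+ ev B x                     ≈⟨ K.+-congʳ (K.trans (K.*-congˡ X[x]≈0) (K.zeroʳ _)) ⟨
    ev A x K.* ev X x K.+ ev B x        ≈⟨ ev-P x ⟨
    ev P x                              ≈⟨ P[x]≈0 ⟩
    K.0#                                ∎

  X-root⇒pow-N≈1 : ∀ {x} → ev X x K.≈ K.0# → pow K x N K.≈ K.1#
  X-root⇒pow-N≈1 {x} X[x]≈0 = KG.x∙y⁻¹≈ε⇒x≈y _ _ (K.trans (K.sym (ev-XpowMinusOne N x)) X[x]≈0)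

  pow-N≈1⇒X-root : ∀ {x} → pow K x N K.≈ K.1# → ev X x K.≈ K.0#
  pow-N≈1⇒X-root {x} xᴺ≈1 = K.trans (ev-XpowMinusOne N x) (KG.x≈y⇒x∙y⁻¹≈ε xᴺ≈1)

  root-of-unity⇒X-root : ∀ {α} → pow K α l K.≈ K.1# → ev X α K.≈ K.0#
  root-of-unity⇒X-root {α} αˡ≈1 = pow-N≈1⇒X-root (begin
    pow K α N               ≈⟨ pow-assocʳ α l (p ^ n) ⟨
    pow K (pow K α l) (p ^ n) ≈⟨ pow-congˡ (p ^ n) αˡ≈1 ⟩
    pow K K.1# (p ^ n)      ≈⟨ pow-1# (p ^ n) ⟩
    K.1#                    ∎)

  coprime⇒distinct : CoprimePol F P Q → DistinctConstantTerms
  coprime⇒distinct coprime A₀≈B₀ =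
    coeff₀≈0⇒¬coprime (IsField.1≉0 F-field) {P} {Q} P₀≈0 coeff₀-Q coprime
    where
    P₀≈0 : coeff P 0 ≈ 0#
    P₀≈0 = trans coeff₀-P
      (x≈y⇒x∙y⁻¹≈ε (trans (sym (eval-at-0 B)) (trans (sym A₀≈B₀) (eval-at-0 A))))

  coprime⇒no-root-of-unity-is-root : CoprimePol F P Q → NoRootOfUnityIsRoot
  coprime⇒no-root-of-unity-is-root coprime α αˡ≈1 B[α]≈0 =
    ConstantTermEuclid.nonzero-common-root⇒¬coprime F-field _≈0? K-field ι-hom P X j
      X₀≉0 (root-of-unity-nonzero 1≤l αˡ≈1) P[α]≈0 X[α]≈0 coprime
    where
    X₀≉0 : ¬ coeff X 0 ≈ 0#
    X₀≉0 -1≈0 = IsField.1≉0 F-field (trans (sym (-‿involutive 1#))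
      (trans (-‿cong (trans (sym (coeff₀-XpowMinusOne 1≤N)) -1≈0)) -0#≈0#))
      where open import Algebra.Properties.Ring ring using (-‿involutive; -0#≈0#)
    X[α]≈0 : ev X α K.≈ K.0#
    X[α]≈0 = root-of-unity⇒X-root αˡ≈1
    P[α]≈0 : ev P α K.≈ K.0#
    P[α]≈0 = K.trans (ev-P α) (K.trans (K.+-cong (K.trans (K.*-congˡ X[α]≈0) (K.zeroʳ _)) B[α]≈0)
                                        (K.+-identityʳ _))

  characteristicᴷ : p ·ᴷ K.1# K.≈ K.0#
  characteristicᴷ = begin
    p ·ᴷ K.1#      ≈⟨ RingHomomorphism.·1#-homo F K ι-hom p ⟨
    ι (p · 1#)     ≈⟨ IsRingHomomorphism.⟦⟧-cong ι-hom (card≡p^e⇒p·1≈0 F-field {p} {e} q≡pᵉ) ⟩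
    ι 0#           ≈⟨ IsRingHomomorphism.0#-homo ι-hom ⟩
    K.0#           ∎

  no-root-of-unity-is-root⇒P≉0 : NoRootOfUnityIsRoot → ¬ P ≋ []
  no-root-of-unity-is-root⇒P≉0 no-root P≋0 = no-root K.1# (pow-1# l)
    (X-root⇒[P-root⇒B-root] (root-of-unity⇒X-root (pow-1# l)) (ev-cong {P} {[]} P≋0 K.1#))

  no-common-root : DistinctConstantTerms → NoRootOfUnityIsRoot →
    ∀ x → ev P x K.≈ K.0# → ev Q x K.≈ K.0# → ⊥
  no-common-root distinct no-root x P[x]≈0 Q[x]≈0 =
    Frobenius.≉1⇒pow-p^n≉1 K K-field p-prime characteristicᴷ n xˡ≉1
      (K.trans (pow-assocʳ x l (p ^ n)) xᴺ≈1)
    where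
    x≉0 : ¬ x K.≈ K.0#
    x≉0 x≈0 = distinct
      (trans (eval-at-0 A) (trans (sym (x∙y⁻¹≈ε⇒x≈y _ _ B₀-A₀≈0)) (sym (eval-at-0 B))))
      where
      B₀-A₀≈0 : coeff B 0 - coeff A 0 ≈ 0#
      B₀-A₀≈0 = trans (sym coeff₀-P) (RingHomomorphism.reflects-0 F K ι-hom F-field _≈0?
                  (IsField.1≉0 K-field) _ (K.trans (K.sym (ev-at-0 P x≈0)) P[x]≈0))
    X[x]≈0 : ev X x K.≈ K.0#
    X[x]≈0 = x*y≈0⇒y≈0 (pow-nonzero x≉0 j)
      (K.trans (K.sym (K.trans (ev-⊛ (Xpow F j) X x) (K.*-congʳ (ev-Xpow j x)))) Q[x]≈0)
    xᴺ≈1 : pow K x N K.≈ K.1#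
    xᴺ≈1 = X-root⇒pow-N≈1 X[x]≈0
    xˡ≉1 : ¬ pow K x l K.≈ K.1#
    xˡ≉1 xˡ≈1 = no-root x xˡ≈1 (X-root⇒[P-root⇒B-root] X[x]≈0 P[x]≈0)

  coprime⇔ : CoprimePol F P Q ⇔ (DistinctConstantTerms × NoRootOfUnityIsRoot)
  coprime⇔ = mk⇔
    (λ coprime → coprime⇒distinct coprime , coprime⇒no-root-of-unity-is-root coprime)
    (λ (distinct , no-root) → AlgebraicClosure.no-common-root⇒coprime F-field _≈0? Fbar
      (no-root-of-unity-is-root⇒P≉0 no-root) (no-common-root distinct no-root))

1≤k*p^n∸1 : ∀ {p k n} → Prime p → 1 ≤ k → 1 ≤ n → 1 ≤ k ℕ.* p ^ n ∸ 1
1≤k*p^n∸1 {p} {k} {suc n} p-prime 1≤k _ = ℕₚ.∸-monoˡ-≤ 1 (begin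
  2                   ≤⟨ ℕ.nonTrivial⇒n>1 p ⟩
  p                   ≤⟨ ℕₚ.m≤m*n p (p ^ n) ⟩
  p ^ suc n           ≤⟨ ℕₚ.m≤n*m (p ^ suc n) k ⟩
  k ℕ.* p ^ suc n     ∎)
  where
  open ℕₚ.≤-Reasoning
  instance
    _ = prime⇒nonTrivial p-prime
    _ = prime⇒nonZero p-prime
    _ = ℕₚ.m^n≢0 p n
    _ = ℕ.>-nonZero 1≤k

lemma3p10 : ∀ {c ℓ c' ℓ' : Level}
    (p q : ℕ) → Prime p → (∃ λ e → 1 ≤ e × q ≡ p ^ e) →
    (F : CommutativeRing c ℓ) → IsField F → HasCard F q →
    (Fbar : AlgClosure F c' ℓ') →
    (m : ℕ) → 1 ≤ m →
    (σ : Fin m → Vec (Fin m) p) → (φ : Fin m → CommutativeRing.Carrier F) →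
    (U V : List (Fin m)) → 1 ≤ length U → 1 ≤ length V →
    (n : ℕ) → 1 ≤ n →
    CoprimePol F
      (Pn F p (length V) (codedIter F σ φ n U) (codedIter F σ φ n V) n)
      (Qn F p (length U) (length V) n)
    ⇔
    ((¬ CommutativeRing._≈_ F
          (eval F (PW F (codedIter F σ φ n U)) (CommutativeRing.0# F))
          (eval F (PW F (codedIter F σ φ n V)) (CommutativeRing.0# F)))
     ×
     (∀ α → CommutativeRing._≈_ (AlgClosure.K Fbar)
              (pow (AlgClosure.K Fbar) α (length V)) (CommutativeRing.1# (AlgClosure.K Fbar)) →
        ¬ CommutativeRing._≈_ (AlgClosure.K Fbar)
            (eval (AlgClosure.K Fbar)
               (map (AlgClosure.ι Fbar) (PW F (codedIter F σ φ n V))) α)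
            (CommutativeRing.0# (AlgClosure.K Fbar))))
lemma3p10 p q p-prime (e , _ , q≡pᵉ) F F-field card Fbar m _ σ φ U V 1≤k 1≤l n 1≤n =
  Criterion.coprime⇔ {e = e} p-prime q≡pᵉ F-field card Fbar
    (PW F (codedIter F σ φ n U)) (PW F (codedIter F σ φ n V)) (1≤k*p^n∸1 p-prime 1≤k 1≤n) 1≤l n
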